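{- The set $S_{0F}$ of sorts that contain no finite trees is the greatest fixed point of the function $f:\mathcal P(S)\to\mathcal P(S)$ given by $f(X) := X\setminus\{ s\in S \mid \exists (g: s_1\times\cdots\times s_n\to s)\in F_s\ \forall i\in\{1,\dots,n\}: s_i\notin X\}$.
   Context: Signature: a set of sorts $S$ and generators, each with an arity $g: s_1\times\cdots\times s_n\to s$ ($n\ge0$); $F_s$ is the (nonempty) set of generators of sort $s$; every sort is assumed to have at least two generators. A tree of sort $s$ is a (possibly infinite) rooted ordered tree whose root is labeled by some $g: s_1\times\cdots\times s_n\to s$ in $F_s$ and whose $n$ children, in order, are roots of trees of sorts $s_1,\dots,s_n$; it is finite if it has finitely many nodes. $\mathcal P(S)$ is the power set of $S$. -}

module Defs where

open import Level using (0ℓ)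
open import Data.List using (List; length; lookup)
open import Data.Fin using (Fin)
open import Data.Product using (Σ; ∃; _×_)
open import Relation.Nullary using (¬_)
open import Relation.Binary.PropositionalEquality using (_≢_)
open import Relation.Unary using (Pred; _≐_; _⊆_)

-- A many-sorted signature: sorts, generators of each sort (F s), and the
-- arity  g : s₁ × ⋯ × sₙ → s  given as the list [s₁, …, sₙ] of argument sorts.
record Signature : Set₁ where
  field
    Sort     : Set
    Gen      : Sort → Set
    args     : {s : Sort} → Gen s → List Sort
    twoGens  : (s : Sort) → Σ (Gen s) λ g₁ → Σ (Gen s) λ g₂ → g₁ ≢ g₂

module _ (Σs : Signature) where
  open Signature Σs

  -- Finite trees of sort s: a root labelled by a generator g ∈ F s with
  -- children, in order, finite trees of the argument sorts of g.
  -- (Inductive, hence well-founded; with finite branching these are exactly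
  -- the trees with finitely many nodes.)
  data FinTree : Sort → Set where
    node : {s : Sort} (g : Gen s) →
           ((i : Fin (length (args g))) → FinTree (lookup (args g) i)) →
           FinTree s

  S0F : Pred Sort 0ℓ
  S0F s = ¬ FinTree s

  f : Pred Sort 0ℓ → Pred Sort 0ℓ
  f X s = X s × ¬ (∃ λ (g : Gen s) →
                     (i : Fin (length (args g))) → ¬ X (lookup (args g) i))

  IsGreatestFixedPoint : Pred Sort 0ℓ → Set₁
  IsGreatestFixedPoint Y = (f Y ≐ Y) × ((X : Pred Sort 0ℓ) → f X ≐ X → X ⊆ Y)

module Submission where

open import Defs
open import Level using (0ℓ)
open import Data.Fin using (Fin)
open import Data.Fin.Properties using (sequence)
open import Data.Product using (_,_; proj₁; proj₂)
open import Effect.Monad using (RawMonad)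
open import Relation.Nullary using (¬_)
open import Relation.Nullary.Negation using (¬¬-Monad)
open import Relation.Unary using (Pred; _⊆_)

-- Since f X ⊆ X always, the greatest fixed point of f is the largest X with
-- X ⊆ f X, i.e. such that every generator of a sort in X has an argument sort
-- in X.  Any such X contains no sort with a finite tree, by induction on the
-- tree.  Conversely S0F is such a set: a generator all of whose (finitely many)
-- argument sorts were not tree-free would, constructively up to double
-- negation, yield a finite tree of its sort.

¬¬-Π-Fin : ∀ {n} {P : Fin n → Set} → (∀ i → ¬ ¬ P i) → ¬ ¬ (∀ i → P i)
¬¬-Π-Fin = sequence (RawMonad.rawApplicative ¬¬-Monad)

module _ (Σs : Signature) where
  open Signature Σs

  f-deflationary : (X : Pred Sort 0ℓ) → f Σs X ⊆ X
  f-deflationary X = proj₁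

  S0F-postfixed : S0F Σs ⊆ f Σs (S0F Σs)
  S0F-postfixed no-tree = no-tree , λ (g , args-tree-free) →
    ¬¬-Π-Fin args-tree-free λ children → no-tree (node g children)

  postfixed⊆S0F : (X : Pred Sort 0ℓ) → X ⊆ f Σs X → X ⊆ S0F Σs
  postfixed⊆S0F X X⊆fX x∈X (node g children) =
    proj₂ (X⊆fX x∈X) (g , λ i xᵢ∈X → postfixed⊆S0F X X⊆fX xᵢ∈X (children i))

lemma2 : (Σs : Signature) → IsGreatestFixedPoint Σs (S0F Σs)
lemma2 Σs =
    (f-deflationary Σs (S0F Σs) , S0F-postfixed Σs)
  , λ X (_ , X⊆fX) → postfixed⊆S0F Σs X X⊆fX
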